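{- Suppose two unrooted binary phylogenetic trees $T_1$ and $T_2$ on the same set of taxa precisely satisfy $k$-interval cospeciation. Then $d_{NNI}(T_1,T_2)\ge k$.
   Context: An unrooted binary tree is a tree in which every non-leaf vertex has degree three, with leaves labeled by taxa. $\varepsilon_T(A,B)$ is the number of edges on the path between taxa $A$ and $B$ in $T$. Two trees satisfy $k$-interval cospeciation ($k$-IC) if $\lvert \varepsilon_{T_1}(A,B)-\varepsilon_{T_2}(A,B)\rvert\le k$ for all pairs of taxa $A,B$; they precisely satisfy $k$-IC if they satisfy $k$-IC but not $(k-1)$-IC. A nearest neighbor interchange (NNI) is the operation which, for an internal edge $uv$ with subtrees $S_1,S_3$ attached at $u$ and $S_2,S_4$ attached at $v$, swaps $S_1$ and $S_2$. The NNI distance $d_{NNI}(T_1,T_2)$ is the minimum number of NNI operations needed to transform $T_1$ into $T_2$. -}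

module Defs where

open import Data.Nat using (ℕ; zero; suc; _+_; _*_; _∸_; _≤_; _<_; ∣_-_∣)
open import Data.Bool using (Bool; true; false; if_then_else_; _∧_; _∨_)
open import Data.Fin using (Fin; _≟_)
open import Data.List using (List; map; allFin)
open import Data.Nat.ListAction using (sum)
open import Data.Product using (Σ; _×_; _,_; ∃)
open import Data.Sum using (_⊎_)
open import Relation.Nullary using (¬_)
open import Relation.Nullary.Decidable using (⌊_⌋)
open import Relation.Binary.PropositionalEquality using (_≡_; _≢_)
open import Function.Bundles using (_↔_; Inverse)

-- Leaf-labelled simple graphs with taxa Fin n.
-- Vertices are Fin V; adjacency is a Bool-valued function; label A is the
-- vertex carrying taxon A.

record LGraph (n : ℕ) : Set where
  field
    V     : ℕ
    adj   : Fin V → Fin V → Bool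
    label : Fin n → Fin V
open LGraph public

degree : ∀ {n} (G : LGraph n) → Fin (V G) → ℕ
degree G u = sum (map (λ w → if adj G u w then 1 else 0) (allFin (V G)))

data Walk {n} (G : LGraph n) : Fin (V G) → Fin (V G) → ℕ → Set where
  here  : ∀ {u} → Walk G u u 0
  _∷_   : ∀ {u w v d} → adj G u w ≡ true → Walk G w v d → Walk G u v (suc d)

-- Unrooted binary phylogenetic tree on taxa Fin n:
-- a finite simple graph which is a tree (nonempty, connected, |E| = |V|-1),
-- whose leaves are exactly the labelled vertices (labelling injective,
-- labelled vertices have degree ≤ 1) and all other vertices have degree 3.
record IsUBTree {n} (G : LGraph n) : Set where
  field
    nonempty    : 1 ≤ V G
    adj-sym     : ∀ u v → adj G u v ≡ adj G v u
    adj-irrefl  : ∀ u → adj G u u ≡ false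
    connected   : ∀ u v → ∃ λ d → Walk G u v d
    edge-count  : sum (map (degree G) (allFin (V G))) ≡ 2 * (V G ∸ 1)
    label-inj   : ∀ A B → label G A ≡ label G B → A ≡ B
    leaf-deg    : ∀ A → degree G (label G A) ≤ 1
    internal    : ∀ u → (Σ (Fin n) λ A → label G A ≡ u) ⊎ degree G u ≡ 3

record UBTree (n : ℕ) : Set where
  field
    graph  : LGraph n
    isTree : IsUBTree graph
open UBTree public

-- Path length ε_T(u,v): number of edges of the path between u and v, i.e.
-- (in a tree) the length of a shortest walk.  Stated relationally.

IsDist : ∀ {n} (G : LGraph n) → Fin (V G) → Fin (V G) → ℕ → Set
IsDist G u v d = Walk G u v d × (∀ d′ → Walk G u v d′ → d ≤ d′)

ε_[_,_]≡_ : ∀ {n} → UBTree n → Fin n → Fin n → ℕ → Set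
ε T [ A , B ]≡ d = IsDist (graph T) (label (graph T) A) (label (graph T) B) d

IC : ∀ {n} → ℕ → UBTree n → UBTree n → Set
IC k T₁ T₂ = ∀ A B d₁ d₂ → ε T₁ [ A , B ]≡ d₁ → ε T₂ [ A , B ]≡ d₂ → ∣ d₁ - d₂ ∣ ≤ k

-- precisely k-IC: k-IC but not (k-1)-IC (the second condition is vacuous for k = 0)
PreciselyIC : ∀ {n} → ℕ → UBTree n → UBTree n → Set
PreciselyIC k T₁ T₂ = IC k T₁ T₂ × (∀ j → k ≡ suc j → ¬ IC j T₁ T₂)

record Iso {n} (G H : LGraph n) : Set where
  field
    bij       : Fin (V G) ↔ Fin (V H)
    adj-pres  : ∀ x y → adj G x y ≡ adj H (Inverse.to bij x) (Inverse.to bij y)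
    label-pres : ∀ A → Inverse.to bij (label G A) ≡ label H A

-- NNI.  For an internal edge uv, a neighbour s₁ ≠ v of u (root of subtree S₁)
-- and a neighbour s₂ ≠ u of v (root of S₂), replace edges u s₁, v s₂ by
-- u s₂, v s₁, i.e. swap S₁ and S₂.

isPair : ∀ {m} → Fin m → Fin m → Fin m → Fin m → Bool
isPair a b x y = (⌊ x ≟ a ⌋ ∧ ⌊ y ≟ b ⌋) ∨ (⌊ x ≟ b ⌋ ∧ ⌊ y ≟ a ⌋)

nniGraph : ∀ {n} (G : LGraph n) (u v s₁ s₂ : Fin (V G)) → LGraph n
nniGraph G u v s₁ s₂ = record
  { V = V G
  ; adj = λ x y → if isPair u s₁ x y ∨ isPair v s₂ x y then false
                  else if isPair u s₂ x y ∨ isPair v s₁ x y then true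
                  else adj G x y
  ; label = label G }

record NNIMove {n} (T T′ : UBTree n) : Set where
  field
    u v s₁ s₂  : Fin (V (graph T))
    uv-edge    : adj (graph T) u v ≡ true
    u-internal : degree (graph T) u ≡ 3
    v-internal : degree (graph T) v ≡ 3
    us₁-edge   : adj (graph T) u s₁ ≡ true
    s₁≢v       : s₁ ≢ v
    vs₂-edge   : adj (graph T) v s₂ ≡ true
    s₂≢u       : s₂ ≢ u
    result     : Iso (nniGraph (graph T) u v s₁ s₂) (graph T′)

data NNISeq {n} : UBTree n → UBTree n → ℕ → Set where
  done : ∀ {T T′} → Iso (graph T) (graph T′) → NNISeq T T′ 0
  step : ∀ {T T″ T′ m} → NNIMove T T″ → NNISeq T″ T′ m → NNISeq T T′ (suc m)

dNNI≥ : ∀ {n} → UBTree n → UBTree n → ℕ → Set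
dNNI≥ T₁ T₂ k = ∀ m → NNISeq T₁ T₂ m → k ≤ m

module Submission where

-- Call G and H m-close when every walk of length d between two taxa in
-- either graph is matched by a walk between the same taxa of length at most
-- m + d in the other.  Closeness is invariant under label-preserving
-- isomorphism and composes additively, so it suffices to show that a single
-- NNI move yields 1-close trees: an NNI sequence of length m then yields
-- m-close trees, and m-closeness bounds every |ε_T₁(A,B) − ε_T₂(A,B)| by m
-- (use the minimality of path lengths in both directions), i.e. gives m-IC.
-- If T₁, T₂ are precisely k-IC and a sequence of length m < k existed, they
-- would be (k-1)-IC, a contradiction.
--
-- The one-move bound is a rerouting lemma: if every edge lost by a change of
-- adjacency has an endpoint in a set U of mutual distance ≤ r and a surviving
-- edge from U to its other endpoint, walks grow by at most r.  For an NNI across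
-- uv we take U = {u, v} and r = 1.  This needs the swapped subtrees to be
-- distinct (s₁ ≢ s₂): otherwise the move merely deletes two edges at u and
-- leaves a vertex of degree 2, which no binary tree has.

open import Defs
open import Data.Nat using (ℕ; zero; suc; _+_; _≤_; z≤n; s≤s; s≤s⁻¹; ∣_-_∣)
open import Data.Nat.Properties
  using (≤-refl; ≤-trans; ≤-total; ≮⇒≥; +-comm; +-assoc; +-monoʳ-≤; +-mono-≤;
         m≤n+m; m≤n⇒m≤1+n; suc-injective; m≤n⇒∣m-n∣≡n∸m; m≤n⇒∣n-m∣≡n∸m;
         m≤n+o⇒m∸n≤o; +-commutativeSemigroup; +-0-commutativeMonoid; module ≤-Reasoning)
open import Algebra.Properties.CommutativeSemigroup +-commutativeSemigroup using (x∙yz≈y∙xz)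
open import Algebra.Properties.CommutativeMonoid.Sum +-0-commutativeMonoid
  using (sum; sum-syntax; sum-remove; sum-permute; sum-cong-≗)
open import Data.Bool using (Bool; true; false; if_then_else_; _∧_; _∨_)
open import Data.Bool.Properties using (∧-comm; ∨-comm; ∨-zeroʳ)
open import Data.Fin as Fin using (Fin; _≟_; punchIn)
open import Data.Fin.Properties using (punchInᵢ≢i)
open import Data.List using (tabulate)
open import Data.List.Properties using (map-tabulate)
open import Data.Nat.ListAction using () renaming (sum to sumˡ)
open import Data.Product using (_×_; _,_; ∃; proj₁; proj₂)
open import Data.Sum using (_⊎_; inj₁; inj₂; [_,_]′; map₂)
open import Function using (_∘_)
open import Function.Bundles using (Inverse)
open import Function.Properties.Inverse using (↔-sym)
open import Relation.Nullary using (¬_; yes; no; contradiction)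
open import Relation.Nullary.Decidable using (⌊_⌋)
open import Relation.Binary.PropositionalEquality
  using (_≡_; _≢_; refl; sym; trans; cong; cong₂; subst; subst₂; ≢-sym;
         ≡-≟-identity; module ≡-Reasoning)

Pair : ∀ {m} → Fin m → Fin m → Fin m → Fin m → Set
Pair a b x y = (x ≡ a × y ≡ b) ⊎ (x ≡ b × y ≡ a)

outsideˡ : ∀ {m} {a b x y : Fin m} → x ≢ a → x ≢ b → ¬ Pair a b x y
outsideˡ x≢a x≢b = [ x≢a ∘ proj₁ , x≢b ∘ proj₁ ]′

outsideʳ : ∀ {m} {a b x y : Fin m} → y ≢ a → y ≢ b → ¬ Pair a b x y
outsideʳ y≢a y≢b = [ y≢b ∘ proj₂ , y≢a ∘ proj₂ ]′

≟-self : ∀ {m} (x : Fin m) → ⌊ x ≟ x ⌋ ≡ true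
≟-self x = cong ⌊_⌋ (≡-≟-identity _≟_ refl)

isPair-sound : ∀ {m} {a b x y : Fin m} → isPair a b x y ≡ true → Pair a b x y
isPair-sound {a = a} {b} {x} {y} e with x ≟ a | y ≟ b | x ≟ b | y ≟ a
... | yes x≡a | yes y≡b | _       | _       = inj₁ (x≡a , y≡b)
... | _       | _       | yes x≡b | yes y≡a = inj₂ (x≡b , y≡a)
... | no _    | _       | no _    | _       = contradiction e λ ()
... | no _    | _       | yes _   | no _    = contradiction e λ ()
... | yes _   | no _    | no _    | _       = contradiction e λ ()
... | yes _   | no _    | yes _   | no _    = contradiction e λ ()

isPair-complete : ∀ {m} {a b x y : Fin m} → Pair a b x y → isPair a b x y ≡ true
isPair-complete {a = a} {b} (inj₁ (refl , refl)) rewrite ≟-self a | ≟-self b = refl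
isPair-complete {a = a} {b} (inj₂ (refl , refl)) rewrite ≟-self a | ≟-self b = ∨-zeroʳ _

isPair-false : ∀ {m} {a b x y : Fin m} → ¬ Pair a b x y → isPair a b x y ≡ false
isPair-false {a = a} {b} {x} {y} ¬p with isPair a b x y in e
... | true  = contradiction (isPair-sound e) ¬p
... | false = refl

isPair-sym : ∀ {m} (a b x y : Fin m) → isPair a b x y ≡ isPair a b y x
isPair-sym a b x y =
  trans (∨-comm (⌊ x ≟ a ⌋ ∧ ⌊ y ≟ b ⌋) _) (cong₂ _∨_ (∧-comm ⌊ x ≟ b ⌋ _) (∧-comm ⌊ x ≟ a ⌋ _))

override : Bool → Bool → Bool → Bool
override r a b = if r then false else if a then true else b

override-keeps : ∀ r a b → b ≡ true → override r a b ≡ true ⊎ r ≡ true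
override-keeps true  a     b _   = inj₂ refl
override-keeps false true  b _   = inj₁ refl
override-keeps false false b b≡t = inj₁ b≡t

override-sources : ∀ r a b → override r a b ≡ true → b ≡ true ⊎ a ≡ true
override-sources false true  b _ = inj₂ refl
override-sources false false b e = inj₁ e

override-sets : ∀ r a b → r ≡ false → b ≡ true ⊎ a ≡ true → override r a b ≡ true
override-sets false true  b _ _          = refl
override-sets false false b _ (inj₁ b≡t) = b≡t

override-cuts : ∀ r a b → r ≡ true → override r a b ≡ false
override-cuts true a b _ = refl

override-unchanged : ∀ r a b → r ≡ false → a ≡ false → override r a b ≡ b
override-unchanged false false b _ _ = refl

eitherPair-sound : ∀ {m} {a b c d x y : Fin m} →
  isPair a b x y ∨ isPair c d x y ≡ true → Pair a b x y ⊎ Pair c d x y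
eitherPair-sound {a = a} {b} {x = x} {y} e with isPair a b x y in ab
... | true  = inj₁ (isPair-sound ab)
... | false = inj₂ (isPair-sound e)

eitherPair-complete : ∀ {m} {a b c d x y : Fin m} →
  Pair a b x y ⊎ Pair c d x y → isPair a b x y ∨ isPair c d x y ≡ true
eitherPair-complete {c = c} {d} {x = x} {y} (inj₁ p) = cong (_∨ isPair c d x y) (isPair-complete p)
eitherPair-complete {a = a} {b} {x = x} {y} (inj₂ p) =
  trans (cong (isPair a b x y ∨_) (isPair-complete p)) (∨-zeroʳ _)

eitherPair-false : ∀ {m} {a b c d x y : Fin m} →
  ¬ (Pair a b x y ⊎ Pair c d x y) → isPair a b x y ∨ isPair c d x y ≡ false
eitherPair-false ¬p = cong₂ _∨_ (isPair-false (¬p ∘ inj₁)) (isPair-false (¬p ∘ inj₂))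

module NNIEdges {n} (G : LGraph n) (u v s₁ s₂ : Fin (V G)) where

  G′ : LGraph n
  G′ = nniGraph G u v s₁ s₂

  Removed Added : Fin (V G) → Fin (V G) → Set
  Removed x y = Pair u s₁ x y ⊎ Pair v s₂ x y
  Added   x y = Pair u s₂ x y ⊎ Pair v s₁ x y

  removed? added? : Fin (V G) → Fin (V G) → Bool
  removed? x y = isPair u s₁ x y ∨ isPair v s₂ x y
  added?   x y = isPair u s₂ x y ∨ isPair v s₁ x y

  lost : ∀ {x y} → adj G x y ≡ true → adj G′ x y ≡ true ⊎ Removed x y
  lost {x} {y} e with override-keeps (removed? x y) (added? x y) (adj G x y) e
  ... | inj₁ e′ = inj₁ e′
  ... | inj₂ r  = inj₂ (eitherPair-sound r)

  gained : ∀ {x y} → adj G′ x y ≡ true → adj G x y ≡ true ⊎ Added x y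
  gained {x} {y} e with override-sources (removed? x y) (added? x y) (adj G x y) e
  ... | inj₁ e′ = inj₁ e′
  ... | inj₂ a  = inj₂ (eitherPair-sound a)

  kept : ∀ {x y} → ¬ Removed x y → adj G x y ≡ true ⊎ Added x y → adj G′ x y ≡ true
  kept {x} {y} ¬r old-or-added =
    override-sets (removed? x y) (added? x y) (adj G x y) (eitherPair-false ¬r)
      (map₂ eitherPair-complete old-or-added)

  cut : ∀ {x y} → Removed x y → adj G′ x y ≡ false
  cut {x} {y} r = override-cuts (removed? x y) (added? x y) (adj G x y) (eitherPair-complete r)

  unchanged : ∀ {x y} → ¬ Removed x y → ¬ Added x y → adj G′ x y ≡ adj G x y
  unchanged {x} {y} ¬r ¬a =
    override-unchanged (removed? x y) (added? x y) _ (eitherPair-false ¬r) (eitherPair-false ¬a)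

  symmetric : (∀ x y → adj G x y ≡ adj G y x) → ∀ x y → adj G′ x y ≡ adj G′ y x
  symmetric adj-sym x y =
    trans (cong₂ (λ r a → override r a (adj G x y)) (flag-sym u s₁ v s₂) (flag-sym u s₂ v s₁))
          (cong (override (removed? y x) (added? y x)) (adj-sym x y))
    where
    flag-sym : ∀ a b c d → isPair a b x y ∨ isPair c d x y ≡ isPair a b y x ∨ isPair c d y x
    flag-sym a b c d = cong₂ _∨_ (isPair-sym a b x y) (isPair-sym c d x y)

reEdge : ∀ {n} (G : LGraph n) → (Fin (V G) → Fin (V G) → Bool) → LGraph n
reEdge G f = record { V = V G ; adj = f ; label = label G }

_++ʷ_ : ∀ {n} {G : LGraph n} {a b c d e} → Walk G a b d → Walk G b c e → Walk G a c (d + e)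
here     ++ʷ W′ = W′
(e ∷ W) ++ʷ W′ = e ∷ (W ++ʷ W′)

Detour : ∀ {m} → (Fin m → Fin m → Bool) → (Fin m → Set) → Fin m → Fin m → Set
Detour f U x y = (U x × ∃ λ c → U c × f c y ≡ true) ⊎ (U y × ∃ λ c → U c × f x c ≡ true)

module Rerouting {n} (G : LGraph n) (f : Fin (V G) → Fin (V G) → Bool)
  (U : Fin (V G) → Set) (r : ℕ)
  (U-close : ∀ {c c′} → U c → U c′ → ∃ λ e → Walk (reEdge G f) c c′ e × e ≤ r)
  (detour : ∀ {x y} → adj G x y ≡ true → f x y ≡ true ⊎ Detour f U x y) where

  H : LGraph n
  H = reEdge G f

  data Rerouted (a b : Fin (V G)) (d : ℕ) : Set where
    intact : ∀ {d′} → Walk H a b d′ → d′ ≤ d → Rerouted a b d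
    broken : ∀ {c c′ e₁ e₂} → U c → U c′ → Walk H a c e₁ → Walk H c′ b e₂ →
             e₁ + e₂ ≤ d → Rerouted a b d

  -- A surviving first edge is prepended; a lost first
  -- edge xy starts a new broken walk: from x ∈ U (empty first piece, second
  -- piece through the detour edge cy) or via the detour edge xc with y ∈ U.
  -- If the rest was already broken, its first piece is discarded.
  reroute : ∀ {a b d} → Walk G a b d → Rerouted a b d
  reroute here = intact here z≤n
  reroute (e ∷ W) with reroute W | detour e
  ... | intact W′ p         | inj₁ e′ = intact (e′ ∷ W′) (s≤s p)
  ... | broken c c′ W₁ W₂ p | inj₁ e′ = broken c c′ (e′ ∷ W₁) W₂ (s≤s p)
  ... | intact W′ p         | inj₂ (inj₁ (Ux , _ , Uc , e′)) = broken Ux Uc here (e′ ∷ W′) (s≤s p)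
  ... | broken _ c′ _ W₂ p  | inj₂ (inj₁ (Ux , _ , _ , _)) =
        broken Ux c′ here W₂ (m≤n⇒m≤1+n (≤-trans (m≤n+m _ _) p))
  ... | intact W′ p         | inj₂ (inj₂ (Uy , _ , Uc , e′)) = broken Uc Uy (e′ ∷ here) W′ (s≤s p)
  ... | broken _ c′ _ W₂ p  | inj₂ (inj₂ (_ , _ , Uc , e′)) =
        broken Uc c′ (e′ ∷ here) W₂ (s≤s (≤-trans (m≤n+m _ _) p))

  -- A broken walk is reconnected through U at a cost of at most r edges.
  stretch : ∀ {a b d} → Walk G a b d → ∃ λ d′ → Walk H a b d′ × d′ ≤ r + d
  stretch {d = d} W with reroute W
  ... | intact W′ p = _ , W′ , ≤-trans p (m≤n+m d r)
  ... | broken {e₁ = e₁} {e₂} c c′ W₁ W₂ p with U-close c c′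
  ...   | k , B , k≤r = _ , W₁ ++ʷ (B ++ʷ W₂) , bound
    where
    open ≤-Reasoning
    bound : e₁ + (k + e₂) ≤ r + d
    bound = begin
      e₁ + (k + e₂) ≡⟨ x∙yz≈y∙xz e₁ k e₂ ⟩
      k + (e₁ + e₂) ≤⟨ +-mono-≤ k≤r p ⟩
      r + d         ∎

swap-stretch : ∀ {n} (G : LGraph n) (f : Fin (V G) → Fin (V G) → Bool) (u v s₁ s₂ : Fin (V G)) →
  (∀ x y → f x y ≡ f y x) → f u v ≡ true → f v s₁ ≡ true → f u s₂ ≡ true →
  (∀ {x y} → adj G x y ≡ true → f x y ≡ true ⊎ (Pair u s₁ x y ⊎ Pair v s₂ x y)) →
  ∀ {a b d} → Walk G a b d → ∃ λ d′ → Walk (reEdge G f) a b d′ × d′ ≤ 1 + d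
swap-stretch G f u v s₁ s₂ f-sym uv vs₁ us₂ lost =
  Rerouting.stretch G f (λ c → c ≡ u ⊎ c ≡ v) 1 bridge detour
  where
  flip : ∀ {x y} → f x y ≡ true → f y x ≡ true
  flip {x} {y} e = trans (f-sym y x) e

  bridge : ∀ {c c′} → c ≡ u ⊎ c ≡ v → c′ ≡ u ⊎ c′ ≡ v → ∃ λ e → Walk (reEdge G f) c c′ e × e ≤ 1
  bridge (inj₁ refl) (inj₁ refl) = 0 , here , z≤n
  bridge (inj₁ refl) (inj₂ refl) = 1 , uv ∷ here , ≤-refl
  bridge (inj₂ refl) (inj₁ refl) = 1 , flip uv ∷ here , ≤-refl
  bridge (inj₂ refl) (inj₂ refl) = 0 , here , z≤n

  detour : ∀ {x y} → adj G x y ≡ true → f x y ≡ true ⊎ Detour f (λ c → c ≡ u ⊎ c ≡ v) x y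
  detour e with lost e
  ... | inj₁ e′ = inj₁ e′
  ... | inj₂ (inj₁ (inj₁ (refl , refl))) = inj₂ (inj₁ (inj₁ refl , v , inj₂ refl , vs₁))
  ... | inj₂ (inj₁ (inj₂ (refl , refl))) = inj₂ (inj₂ (inj₁ refl , v , inj₂ refl , flip vs₁))
  ... | inj₂ (inj₂ (inj₁ (refl , refl))) = inj₂ (inj₁ (inj₂ refl , u , inj₁ refl , us₂))
  ... | inj₂ (inj₂ (inj₂ (refl , refl))) = inj₂ (inj₂ (inj₂ refl , u , inj₁ refl , flip us₂))

Stretch : ∀ {n} → ℕ → LGraph n → LGraph n → Set
Stretch m G H = ∀ {A B d} → Walk G (label G A) (label G B) d →
  ∃ λ d′ → Walk H (label H A) (label H B) d′ × d′ ≤ m + d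

Close : ∀ {n} → ℕ → LGraph n → LGraph n → Set
Close m G H = Stretch m G H × Stretch m H G

stretch-trans : ∀ {n} {a b} {G H K : LGraph n} → Stretch a G H → Stretch b H K → Stretch (a + b) G K
stretch-trans {a = a} {b} s t {d = d} W with s W
... | d₁ , W₁ , d₁≤ with t W₁
...   | d₂ , W₂ , d₂≤ = d₂ , W₂ , bound
  where
  open ≤-Reasoning
  bound : d₂ ≤ a + b + d
  bound = begin
    d₂          ≤⟨ d₂≤ ⟩
    b + d₁      ≤⟨ +-monoʳ-≤ b d₁≤ ⟩
    b + (a + d) ≡⟨ x∙yz≈y∙xz b a d ⟩
    a + (b + d) ≡⟨ sym (+-assoc a b d) ⟩
    a + b + d   ∎

close-trans : ∀ {n} {a b} {G H K : LGraph n} → Close a G H → Close b H K → Close (a + b) G K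
close-trans {a = a} {b} {G} {K = K} (s , s′) (t , t′) =
  stretch-trans s t , subst (λ m → Stretch m K G) (+-comm b a) (stretch-trans t′ s′)

module _ {n} {G H : LGraph n} (I : Iso G H) where
  open Iso I

  private
    to : Fin (V G) → Fin (V H)
    to = Inverse.to bij
    from : Fin (V H) → Fin (V G)
    from = Inverse.from bij

  iso-walk : ∀ {x y d} → Walk G x y d → Walk H (to x) (to y) d
  iso-walk here = here
  iso-walk (_∷_ {u = x} {w = w} e W) = trans (sym (adj-pres x w)) e ∷ iso-walk W

  iso-stretch : Stretch 0 G H
  iso-stretch {A} {B} {d} W =
    d , subst₂ (λ x y → Walk H x y d) (label-pres A) (label-pres B) (iso-walk W) , ≤-refl

  iso-sym : Iso H G
  iso-sym = record
    { bij = ↔-sym bij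
    ; adj-pres = λ x y → trans (cong₂ (adj H) (sym (to∘from x)) (sym (to∘from y)))
                               (sym (adj-pres (from x) (from y)))
    ; label-pres = λ A → trans (cong from (sym (label-pres A))) (from∘to (label G A)) }
    where
    to∘from : ∀ y → to (from y) ≡ y
    to∘from = Inverse.strictlyInverseˡ bij
    from∘to : ∀ x → from (to x) ≡ x
    from∘to = Inverse.strictlyInverseʳ bij

close-iso : ∀ {n} {G H : LGraph n} → Iso G H → Close 0 G H
close-iso I = iso-stretch I , iso-stretch (iso-sym I)

indicator : Bool → ℕ
indicator b = if b then 1 else 0

degree≡∑ : ∀ {n} (G : LGraph n) (u : Fin (V G)) → degree G u ≡ ∑[ w < V G ] indicator (adj G u w)
degree≡∑ G u =
  trans (cong sumˡ (map-tabulate (λ w → w) (indicator ∘ adj G u))) (sumˡ-tabulate (indicator ∘ adj G u))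
  where
  sumˡ-tabulate : ∀ {m} (g : Fin m → ℕ) → sumˡ (tabulate g) ≡ sum g
  sumˡ-tabulate {zero}  g = refl
  sumˡ-tabulate {suc m} g = cong (g Fin.zero +_) (sumˡ-tabulate (g ∘ Fin.suc))

degree-iso : ∀ {n} {G H : LGraph n} (I : Iso G H) (x : Fin (V G)) →
  degree H (Inverse.to (Iso.bij I) x) ≡ degree G x
degree-iso {G = G} {H} I x = begin
  degree H (to x)                              ≡⟨ degree≡∑ H (to x) ⟩
  ∑[ z < V H ] indicator (adj H (to x) z)      ≡⟨ sum-permute _ (Iso.bij I) ⟩
  ∑[ y < V G ] indicator (adj H (to x) (to y)) ≡⟨ sum-cong-≗ (cong indicator ∘ sym ∘ Iso.adj-pres I x) ⟩
  ∑[ y < V G ] indicator (adj G x y)           ≡⟨ sym (degree≡∑ G x) ⟩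
  degree G x                                   ∎
  where
  open ≡-Reasoning
  to : Fin (V G) → Fin (V H)
  to = Inverse.to (Iso.bij I)

∑-dropOne : ∀ {m} (g h : Fin m → ℕ) (w : Fin m) → g w ≡ 1 → h w ≡ 0 →
  (∀ y → y ≢ w → g y ≡ h y) → sum g ≡ suc (sum h)
∑-dropOne {suc m} g h w gw≡1 hw≡0 agree = begin
  sum g                           ≡⟨ sum-remove {i = w} g ⟩
  g w + sum (g ∘ punchIn w)       ≡⟨ cong₂ _+_ gw≡1 (sum-cong-≗ λ j → agree (punchIn w j) (punchInᵢ≢i w j)) ⟩
  suc (sum (h ∘ punchIn w))       ≡⟨ cong (λ z → suc (z + sum (h ∘ punchIn w))) (sym hw≡0) ⟩
  suc (h w + sum (h ∘ punchIn w)) ≡⟨ cong suc (sym (sum-remove {i = w} h)) ⟩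
  suc (sum h)                     ∎
  where open ≡-Reasoning

degree-removeEdge : ∀ {n} (G : LGraph n) (f : Fin (V G) → Fin (V G) → Bool) (u w : Fin (V G)) →
  adj G u w ≡ true → f u w ≡ false → (∀ y → y ≢ w → f u y ≡ adj G u y) →
  degree G u ≡ suc (degree (reEdge G f) u)
degree-removeEdge G f u w uw fuw agree = begin
  degree G u                                ≡⟨ degree≡∑ G u ⟩
  ∑[ y < V G ] indicator (adj G u y)        ≡⟨ ∑-dropOne _ _ w (cong indicator uw) (cong indicator fuw)
                                                 (λ y y≢w → cong indicator (sym (agree y y≢w))) ⟩
  suc (∑[ y < V G ] indicator (f u y))      ≡⟨ cong suc (sym (degree≡∑ (reEdge G f) u)) ⟩
  suc (degree (reEdge G f) u)               ∎
  where open ≡-Reasoning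

no-degree-two : ∀ {n} {H : LGraph n} → IsUBTree H → ∀ x → degree H x ≢ 2
no-degree-two tr x deg≡2 with IsUBTree.internal tr x
... | inj₁ (A , refl) = contradiction (subst (_≤ 1) deg≡2 (IsUBTree.leaf-deg tr A)) λ { (s≤s ()) }
... | inj₂ deg≡3      = contradiction (trans (sym deg≡2) deg≡3) λ ()

edge-irrefl : ∀ {n} {G : LGraph n} → IsUBTree G → ∀ {x y} → adj G x y ≡ true → x ≢ y
edge-irrefl tr {x} e refl = contradiction (trans (sym e) (IsUBTree.adj-irrefl tr x)) λ ()

nni-close : ∀ {n} (G : LGraph n) {u v s₁ s₂ : Fin (V G)} →
  (∀ x y → adj G x y ≡ adj G y x) →
  adj G u v ≡ true → adj G u s₁ ≡ true → adj G v s₂ ≡ true →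
  u ≢ v → s₁ ≢ v → s₂ ≢ u → s₁ ≢ s₂ →
  Close 1 G (nniGraph G u v s₁ s₂)
nni-close G {u} {v} {s₁} {s₂} adj-sym uv us₁ vs₂ u≢v s₁≢v s₂≢u s₁≢s₂ =
  swap-stretch G (adj G′) u v s₁ s₂ (symmetric adj-sym) uv′ vs₁′ us₂′ lost ,
  swap-stretch G′ (adj G) u v s₂ s₁ adj-sym uv vs₂ us₁ gained
  where
  open NNIEdges G u v s₁ s₂
  uv′ : adj G′ u v ≡ true
  uv′ = kept [ outsideʳ (≢-sym u≢v) (≢-sym s₁≢v) , outsideˡ u≢v (≢-sym s₂≢u) ]′ (inj₁ uv)
  vs₁′ : adj G′ v s₁ ≡ true
  vs₁′ = kept [ outsideˡ (≢-sym u≢v) (≢-sym s₁≢v) , outsideʳ s₁≢v s₁≢s₂ ]′ (inj₂ (inj₂ (inj₁ (refl , refl))))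
  us₂′ : adj G′ u s₂ ≡ true
  us₂′ = kept [ outsideʳ s₂≢u (≢-sym s₁≢s₂) , outsideˡ u≢v (≢-sym s₂≢u) ]′ (inj₂ (inj₁ (inj₁ (refl , refl))))

-- With s₁ = s₂ = w the "move" only deletes the edges uw and vw, so u loses
-- exactly one neighbour.
nni-degenerate-degree : ∀ {n} (G : LGraph n) (u v w : Fin (V G)) →
  u ≢ v → u ≢ w → adj G u w ≡ true → degree G u ≡ suc (degree (nniGraph G u v w w) u)
nni-degenerate-degree G u v w u≢v u≢w uw =
  degree-removeEdge G (adj G′) u w uw (cut (inj₁ (inj₁ (refl , refl))))
    (λ y y≢w → unchanged (not-removed y≢w) (not-removed y≢w))
  where
  open NNIEdges G u v w w
  not-removed : ∀ {y} → y ≢ w → ¬ Removed u y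
  not-removed y≢w = [ [ y≢w ∘ proj₂ , u≢w ∘ proj₁ ]′ , outsideˡ u≢v u≢w ]′

-- Hence the two subtrees swapped by an NNI move between binary trees differ:
-- otherwise u would have degree 2 in the resulting tree.
nni-branches-distinct : ∀ {n} {T T″ : UBTree n} (mv : NNIMove T T″) → NNIMove.s₁ mv ≢ NNIMove.s₂ mv
nni-branches-distinct {n} {T} {T″} mv s₁≡s₂ = no-degree-two (isTree T″) _ degree-two
  where
  open NNIMove mv
  G : LGraph n
  G = graph T
  I : Iso (nniGraph G u v s₁ s₁) (graph T″)
  I = subst (λ s → Iso (nniGraph G u v s₁ s) (graph T″)) (sym s₁≡s₂) result
  degree-two : degree (graph T″) (Inverse.to (Iso.bij I) u) ≡ 2
  degree-two = trans (degree-iso I u)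
    (suc-injective (trans (sym (nni-degenerate-degree G u v s₁
      (edge-irrefl (isTree T) uv-edge) (edge-irrefl (isTree T) us₁-edge) us₁-edge)) u-internal))

close-nni : ∀ {n} {T T″ : UBTree n} → NNIMove T T″ → Close 1 (graph T) (graph T″)
close-nni {T = T} mv = close-trans {a = 1} {b = 0} swap (close-iso result)
  where
  open NNIMove mv
  swap : Close 1 (graph T) (nniGraph (graph T) u v s₁ s₂)
  swap = nni-close (graph T) (IsUBTree.adj-sym (isTree T)) uv-edge us₁-edge vs₂-edge
           (edge-irrefl (isTree T) uv-edge) s₁≢v s₂≢u (nni-branches-distinct mv)

close-seq : ∀ {n} {T T′ : UBTree n} {m} → NNISeq T T′ m → Close m (graph T) (graph T′)
close-seq (done I)    = close-iso I
close-seq (step mv S) = close-trans (close-nni mv) (close-seq S)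

∣-∣≤-from-bounds : ∀ {m d₁ d₂} → d₂ ≤ m + d₁ → d₁ ≤ m + d₂ → ∣ d₁ - d₂ ∣ ≤ m
∣-∣≤-from-bounds {m} {d₁} {d₂} d₂≤ d₁≤ with ≤-total d₁ d₂
... | inj₁ d₁≤d₂ = subst (_≤ m) (sym (m≤n⇒∣m-n∣≡n∸m d₁≤d₂))
                     (m≤n+o⇒m∸n≤o d₂ d₁ (subst (d₂ ≤_) (+-comm m d₁) d₂≤))
... | inj₂ d₂≤d₁ = subst (_≤ m) (sym (m≤n⇒∣n-m∣≡n∸m d₂≤d₁))
                     (m≤n+o⇒m∸n≤o d₁ d₂ (subst (d₁ ≤_) (+-comm m d₂) d₁≤))

-- m-close trees satisfy m-IC: a shortest path in one tree, carried over, bounds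
-- the path length in the other.
close⇒IC : ∀ {n} {T₁ T₂ : UBTree n} {m} → Close m (graph T₁) (graph T₂) → IC m T₁ T₂
close⇒IC (to₂ , to₁) A B d₁ d₂ (W₁ , shortest₁) (W₂ , shortest₂)
  with to₂ W₁ | to₁ W₂
... | e₁ , W₁′ , e₁≤ | e₂ , W₂′ , e₂≤ =
  ∣-∣≤-from-bounds (≤-trans (shortest₂ e₁ W₁′) e₁≤) (≤-trans (shortest₁ e₂ W₂′) e₂≤)

nniSeq⇒IC : ∀ {n} {T₁ T₂ : UBTree n} {m} → NNISeq T₁ T₂ m → IC m T₁ T₂
nniSeq⇒IC {T₁ = T₁} {T₂} S = close⇒IC {T₁ = T₁} {T₂} (close-seq S)

IC-mono : ∀ {n} {T₁ T₂ : UBTree n} {j k} → j ≤ k → IC j T₁ T₂ → IC k T₁ T₂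
IC-mono j≤k ic A B d₁ d₂ p q = ≤-trans (ic A B d₁ d₂ p q) j≤k

theorem3 : ∀ {n} (T₁ T₂ : UBTree n) (k : ℕ) → PreciselyIC k T₁ T₂ → dNNI≥ T₁ T₂ k
theorem3 T₁ T₂ zero    _              m S = z≤n
theorem3 T₁ T₂ (suc j) (_ , not-j-IC) m S =
  ≮⇒≥ λ m<k → not-j-IC j refl (IC-mono {T₁ = T₁} {T₂} (s≤s⁻¹ m<k) (nniSeq⇒IC S))
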